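{- Let $G$ be a basic CUH graph that omits $D$ and in which at least one of the two color classes is not an independent set. If $D\in O(G)$, then $\widetilde{D}\in O(G)$.
   Context: All graphs are simple. A 2-colored graph is a graph with a map $\chi\colon V(G)\to\{\text{red},\text{blue}\}$; $R,B$ are the red and blue vertex sets; induced subgraphs inherit colors; isomorphisms are color-preserving. $G$ is ultrahomogeneous if every isomorphism between finite induced subgraphs extends to an automorphism. A CUH graph is a countably infinite ultrahomogeneous 2-colored graph in which $G[R]$ and $G[B]$ are disjoint unions of cliques; $\alpha_R,\alpha_B$ are the independence numbers of $G[R],G[B]$. $G$ is a blow-up if for one color $c$ (other color $c'$) there are a 2-colored graph $H$ whose $c$-colored vertices are independent and $i\in\mathbb{N}_{\ge2}\cup\{\aleph_0\}$ such that $G$ arises from $H$ by replacing each $c$-colored vertex $u$ by a $c$-colored $i$-clique whose vertices are adjacent exactly to the other vertices of the clique and to the $c'$-colored neighbors of $u$ in $H$. A CUH graph is basic if it is not a blow-up and $\min\{\alpha_R,\alpha_B\}\ge2$. A finite 2-colored graph is realized in $G$ if isomorphic to an induced subgraph of $G$, omitted otherwise, and minimally omitted if omitted while all proper induced subgraphs are realized; $O(G)$ is the set of minimally omitted graphs. $D$: red $r_1,r_2$, blue $b_1,b_2$, edges $r_1r_2,b_1b_2,r_1b_1,r_1b_2,r_2b_1$. $\widetilde{D}$: red $r_1,r_2$, blue $b_1,b_2$, edges $r_1r_2,b_1b_2,r_2b_2$. -}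

module Defs where

open import Data.Nat using (ℕ; _<_; _≤_)
open import Data.Fin using (Fin; zero; suc)
open import Data.Bool using (Bool; true; false)
open import Data.Product using (Σ; _×_; _,_)
open import Data.Sum using (_⊎_; inj₁; inj₂)
open import Data.Empty using (⊥)
open import Relation.Nullary using (¬_)
open import Relation.Binary.PropositionalEquality using (_≡_; _≢_; refl)
open import Function.Bundles using (_↔_; Inverse)
open import Function.Definitions using (Injective)

data Color : Set where
  red blue : Color

opp : Color → Color
opp red = blue
opp blue = red

-- Countably infinite 2-coloured simple graphs: vertex set ℕ
-- (every countably infinite graph is isomorphic to one on ℕ, and all
-- notions below are isomorphism invariant).

record CGraph : Set where
  field
    adj    : ℕ → ℕ → Bool
    col    : ℕ → Color
    sym    : ∀ x y → adj x y ≡ adj y x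
    irrefl : ∀ x → adj x x ≡ false
open CGraph public

record FGraph (n : ℕ) : Set where
  field
    adj    : Fin n → Fin n → Bool
    col    : Fin n → Color
    sym    : ∀ i j → adj i j ≡ adj j i
    irrefl : ∀ i → adj i i ≡ false

restrict : ∀ {m n} → FGraph n → (Fin m → Fin n) → FGraph m
restrict H g = record
  { adj = λ i j → FGraph.adj H (g i) (g j)
  ; col = λ i → FGraph.col H (g i)
  ; sym = λ i j → FGraph.sym H (g i) (g j)
  ; irrefl = λ i → FGraph.irrefl H (g i)
  }

Realized : ∀ {n} → CGraph → FGraph n → Set
Realized {n} G H =
  Σ (Fin n → ℕ) λ f →
    Injective _≡_ _≡_ f ×
    (∀ i → col G (f i) ≡ FGraph.col H i) ×
    (∀ i j → adj G (f i) (f j) ≡ FGraph.adj H i j)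

Omitted : ∀ {n} → CGraph → FGraph n → Set
Omitted G H = ¬ Realized G H

-- H ∈ O(G): omitted, while every proper induced subgraph
-- (induced on an m-element vertex subset, m < n) is realized
MinOmitted : ∀ {n} → CGraph → FGraph n → Set
MinOmitted {n} G H =
  Omitted G H ×
  (∀ m → m < n → (g : Fin m → Fin n) → Injective _≡_ _≡_ g →
     Realized G (restrict H g))

IsAutomorphism : CGraph → ℕ ↔ ℕ → Set
IsAutomorphism G σ =
  (∀ x → col G (Inverse.to σ x) ≡ col G x) ×
  (∀ x y → adj G (Inverse.to σ x) (Inverse.to σ y) ≡ adj G x y)

-- An isomorphism between finite induced subgraphs is given by two
-- injective enumerations f, g of the domain and codomain such that
-- f i ↦ g i preserves colours and adjacency.
Ultrahomogeneous : CGraph → Set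
Ultrahomogeneous G =
  ∀ n (f g : Fin n → ℕ) →
    Injective _≡_ _≡_ f → Injective _≡_ _≡_ g →
    (∀ i → col G (f i) ≡ col G (g i)) →
    (∀ i j → adj G (f i) (f j) ≡ adj G (g i) (g j)) →
    Σ (ℕ ↔ ℕ) λ σ → IsAutomorphism G σ × (∀ i → Inverse.to σ (f i) ≡ g i)

-- G[c] is a disjoint union of cliques: the c-coloured vertices are
-- partitioned into classes (labelled by cl) and two distinct
-- c-coloured vertices are adjacent iff they lie in the same class.
UnionOfCliques : CGraph → Color → Set
UnionOfCliques G c =
  Σ (ℕ → ℕ) λ cl →
    ∀ x y → col G x ≡ c → col G y ≡ c → x ≢ y →
      (adj G x y ≡ true → cl x ≡ cl y) × (cl x ≡ cl y → adj G x y ≡ true)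

CUH : CGraph → Set
CUH G = Ultrahomogeneous G × UnionOfCliques G red × UnionOfCliques G blue

AlphaAtLeast2 : CGraph → Color → Set
AlphaAtLeast2 G c =
  Σ ℕ λ x → Σ ℕ λ y →
    x ≢ y × col G x ≡ c × col G y ≡ c × adj G x y ≡ false

NotIndependent : CGraph → Color → Set
NotIndependent G c =
  Σ ℕ λ x → Σ ℕ λ y → col G x ≡ c × col G y ≡ c × adj G x y ≡ true

-- clique sizes i ∈ ℕ_{≥2} ∪ {ℵ₀}
data Mult : Set where
  fin    : (i : ℕ) → 2 ≤ i → Mult
  aleph0 : Mult

Card : Mult → Set
Card (fin i _) = Fin i
Card aleph0 = ℕ

record AGraph : Set₁ where
  field
    W      : Set
    adj    : W → W → Bool
    col    : W → Color
    sym    : ∀ x y → adj x y ≡ adj y x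
    irrefl : ∀ x → adj x x ≡ false

module BlowUp (H : AGraph) (c : Color) (i : Mult) where
  open AGraph H renaming (adj to hadj; col to hcol)

  -- vertices of the blow-up: c'-vertices of H, and pairs
  -- (c-vertex u of H, index in the i-clique replacing u)
  BV : Set
  BV = (Σ W λ w → hcol w ≡ opp c) ⊎ ((Σ W λ w → hcol w ≡ c) × Card i)

  Bcol : BV → Color
  Bcol (inj₁ _) = opp c
  Bcol (inj₂ _) = c

  Badj : BV → BV → Set
  Badj (inj₁ (v , _)) (inj₁ (w , _)) = hadj v w ≡ true
  Badj (inj₁ (v , _)) (inj₂ ((u , _) , _)) = hadj v u ≡ true
  Badj (inj₂ ((u , _) , _)) (inj₁ (v , _)) = hadj u v ≡ true
  Badj (inj₂ ((u , _) , k)) (inj₂ ((u′ , _) , k′)) = u ≡ u′ × k ≢ k′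

CIndependent : AGraph → Color → Set
CIndependent H c =
  ∀ x y → AGraph.col H x ≡ c → AGraph.col H y ≡ c → AGraph.adj H x y ≡ false

IsBlowUpOf : CGraph → AGraph → Color → Mult → Set
IsBlowUpOf G H c i =
  Σ (BV ↔ ℕ) λ φ →
    (∀ x → col G (Inverse.to φ x) ≡ Bcol x) ×
    (∀ x y → (adj G (Inverse.to φ x) (Inverse.to φ y) ≡ true → Badj x y) ×
             (Badj x y → adj G (Inverse.to φ x) (Inverse.to φ y) ≡ true))
  where open BlowUp H c i

IsBlowUp : CGraph → Set₁
IsBlowUp G =
  Σ Color λ c → Σ AGraph λ H → Σ Mult λ i →
    CIndependent H c × IsBlowUpOf G H c i

Basic : CGraph → Set₁
Basic G = ¬ IsBlowUp G × AlphaAtLeast2 G red × AlphaAtLeast2 G blue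

-- The graphs D and D̃ (vertex 0 = r₁, 1 = r₂, 2 = b₁, 3 = b₂)

D-adj : Fin 4 → Fin 4 → Bool
D-adj zero zero = false
D-adj zero (suc zero) = true
D-adj zero (suc (suc zero)) = true
D-adj zero (suc (suc (suc zero))) = true
D-adj (suc zero) zero = true
D-adj (suc zero) (suc zero) = false
D-adj (suc zero) (suc (suc zero)) = true
D-adj (suc zero) (suc (suc (suc zero))) = false
D-adj (suc (suc zero)) zero = true
D-adj (suc (suc zero)) (suc zero) = true
D-adj (suc (suc zero)) (suc (suc zero)) = false
D-adj (suc (suc zero)) (suc (suc (suc zero))) = true
D-adj (suc (suc (suc zero))) zero = true
D-adj (suc (suc (suc zero))) (suc zero) = false
D-adj (suc (suc (suc zero))) (suc (suc zero)) = true
D-adj (suc (suc (suc zero))) (suc (suc (suc zero))) = false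

D-sym : ∀ i j → D-adj i j ≡ D-adj j i
D-sym zero zero = refl
D-sym zero (suc zero) = refl
D-sym zero (suc (suc zero)) = refl
D-sym zero (suc (suc (suc zero))) = refl
D-sym (suc zero) zero = refl
D-sym (suc zero) (suc zero) = refl
D-sym (suc zero) (suc (suc zero)) = refl
D-sym (suc zero) (suc (suc (suc zero))) = refl
D-sym (suc (suc zero)) zero = refl
D-sym (suc (suc zero)) (suc zero) = refl
D-sym (suc (suc zero)) (suc (suc zero)) = refl
D-sym (suc (suc zero)) (suc (suc (suc zero))) = refl
D-sym (suc (suc (suc zero))) zero = refl
D-sym (suc (suc (suc zero))) (suc zero) = refl
D-sym (suc (suc (suc zero))) (suc (suc zero)) = refl
D-sym (suc (suc (suc zero))) (suc (suc (suc zero))) = refl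

D-irr : ∀ i → D-adj i i ≡ false
D-irr zero = refl
D-irr (suc zero) = refl
D-irr (suc (suc zero)) = refl
D-irr (suc (suc (suc zero))) = refl

D-col : Fin 4 → Color
D-col zero = red
D-col (suc zero) = red
D-col (suc (suc _)) = blue

D : FGraph 4
D = record { adj = D-adj ; col = D-col ; sym = D-sym ; irrefl = D-irr }

Dtilde-adj : Fin 4 → Fin 4 → Bool
Dtilde-adj zero zero = false
Dtilde-adj zero (suc zero) = true
Dtilde-adj zero (suc (suc zero)) = false
Dtilde-adj zero (suc (suc (suc zero))) = false
Dtilde-adj (suc zero) zero = true
Dtilde-adj (suc zero) (suc zero) = false
Dtilde-adj (suc zero) (suc (suc zero)) = false
Dtilde-adj (suc zero) (suc (suc (suc zero))) = true
Dtilde-adj (suc (suc zero)) zero = false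
Dtilde-adj (suc (suc zero)) (suc zero) = false
Dtilde-adj (suc (suc zero)) (suc (suc zero)) = false
Dtilde-adj (suc (suc zero)) (suc (suc (suc zero))) = true
Dtilde-adj (suc (suc (suc zero))) zero = false
Dtilde-adj (suc (suc (suc zero))) (suc zero) = true
Dtilde-adj (suc (suc (suc zero))) (suc (suc zero)) = true
Dtilde-adj (suc (suc (suc zero))) (suc (suc (suc zero))) = false

Dtilde-sym : ∀ i j → Dtilde-adj i j ≡ Dtilde-adj j i
Dtilde-sym zero zero = refl
Dtilde-sym zero (suc zero) = refl
Dtilde-sym zero (suc (suc zero)) = refl
Dtilde-sym zero (suc (suc (suc zero))) = refl
Dtilde-sym (suc zero) zero = refl
Dtilde-sym (suc zero) (suc zero) = refl
Dtilde-sym (suc zero) (suc (suc zero)) = refl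
Dtilde-sym (suc zero) (suc (suc (suc zero))) = refl
Dtilde-sym (suc (suc zero)) zero = refl
Dtilde-sym (suc (suc zero)) (suc zero) = refl
Dtilde-sym (suc (suc zero)) (suc (suc zero)) = refl
Dtilde-sym (suc (suc zero)) (suc (suc (suc zero))) = refl
Dtilde-sym (suc (suc (suc zero))) zero = refl
Dtilde-sym (suc (suc (suc zero))) (suc zero) = refl
Dtilde-sym (suc (suc (suc zero))) (suc (suc zero)) = refl
Dtilde-sym (suc (suc (suc zero))) (suc (suc (suc zero))) = refl

Dtilde-irr : ∀ i → Dtilde-adj i i ≡ false
Dtilde-irr zero = refl
Dtilde-irr (suc zero) = refl
Dtilde-irr (suc (suc zero)) = refl
Dtilde-irr (suc (suc (suc zero))) = refl

Dtilde-col : Fin 4 → Color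
Dtilde-col zero = red
Dtilde-col (suc zero) = red
Dtilde-col (suc (suc _)) = blue

Dtilde : FGraph 4
Dtilde = record { adj = Dtilde-adj ; col = Dtilde-col ; sym = Dtilde-sym ; irrefl = Dtilde-irr }

-- Every red–blue edge of G extends to a red triangle like r₁r₂b₁ of D, since D − b₂ is realized
-- and G is ultrahomogeneous.  Given a copy r₁r₂b₁b₂ of D̃, let s be such a red apex over the edge
-- r₂b₂.  If s ~ b₁ then s r₂ b₂ b₁ is a copy of D.  Otherwise r₂ s b₁ and r₂ r₁ b₁ are copies of
-- the same graph, so an automorphism sends b₂ to a blue z adjacent to r₂, r₁ and b₁; as the blue
-- vertices form cliques, z ~ b₂, and r₂ r₁ z b₂ is a copy of D.  Either way D would be realized.
-- The proper subgraphs of D̃ arise from those of D in the same way.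
module Submission where

open import Defs
open import Data.Bool using (true; false)
import Data.Bool as Bool
open import Data.Empty using (⊥)
open import Data.Fin using (Fin; punchIn; punchOut; _≟_)
open import Data.Fin.Patterns using (0F; 1F; 2F; 3F)
open import Data.Fin.Properties
  using (any?; all?; ¬∀⟶∃¬; injective⇒≤; punchIn-injective; punchIn-punchOut)
open import Data.Nat using (ℕ; suc; _<_)
open import Data.Nat.Properties using (<⇒≱; n<1+n)
open import Data.Product using (Σ; ∃; _×_; _,_; proj₁; proj₂)
open import Data.Vec.Functional using ([]; _∷_)
open import Function using (_∘_)
open import Function.Bundles using (Inverse)
open import Function.Definitions using (Injective)
open import Relation.Binary.Definitions using (DecidableEquality)
open import Relation.Binary.PropositionalEquality
  using (_≡_; _≢_; refl; trans; cong; cong₂) renaming (sym to ≡-sym)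
open import Relation.Nullary using (Dec; yes; no; ¬?; contradiction)
open import Relation.Nullary.Decidable using (_→-dec_; toWitness; decidable-stable)

_≟ᶜ_ : DecidableEquality Color
red  ≟ᶜ red  = yes refl
red  ≟ᶜ blue = no λ ()
blue ≟ᶜ red  = no λ ()
blue ≟ᶜ blue = yes refl

_∖_ : ∀ {n} → FGraph (suc n) → Fin (suc n) → FGraph n
H ∖ k = restrict H (punchIn k)

missed-value : ∀ {m n} → m < n → (g : Fin m → Fin n) → ∃ λ k → ∀ i → g i ≢ k
missed-value {m} {n} m<n g with any? (λ k → all? (λ i → ¬? (g i ≟ k)))
... | yes missed = missed
... | no ¬missed = contradiction (injective⇒≤ section-injective) (<⇒≱ m<n)
  where
  preimage : ∀ k → ∃ λ i → g i ≡ k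
  preimage k with ¬∀⟶∃¬ m _ (λ i → ¬? (g i ≟ k)) (λ g≢k → ¬missed (k , g≢k))
  ... | i , ¬g≢k = i , decidable-stable (g i ≟ k) ¬g≢k

  section-injective : Injective _≡_ _≡_ (proj₁ ∘ preimage)
  section-injective {k} {l} e =
    trans (≡-sym (proj₂ (preimage k))) (trans (cong g e) (proj₂ (preimage l)))

module _ {n} (H : FGraph n) where
  open FGraph H renaming (adj to hadj; col to hcol)

  TwinFree : Set
  TwinFree = ∀ i j → hcol i ≡ hcol j → (∀ k → hadj i k ≡ hadj j k) → i ≡ j

  twinFree? : Dec TwinFree
  twinFree? = all? λ i → all? λ j →
    (hcol i ≟ᶜ hcol j) →-dec (all? λ k → hadj i k Bool.≟ hadj j k) →-dec (i ≟ j)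

red-blue-edge : FGraph 2
red-blue-edge = restrict D (0F ∷ 2F ∷ [])

red-blue-edge-twinFree : TwinFree red-blue-edge
red-blue-edge-twinFree = toWitness {a? = twinFree? red-blue-edge} _

D-twinFree : TwinFree D
D-twinFree = toWitness {a? = twinFree? D} _

Dtilde-deletion-twinFree : ∀ k → TwinFree (Dtilde ∖ k)
Dtilde-deletion-twinFree = toWitness {a? = all? λ k → twinFree? (Dtilde ∖ k)} _

module _ (G : CGraph) where

  adj-flip : ∀ {x y b} → adj G x y ≡ b → adj G y x ≡ b
  adj-flip {x} {y} e = trans (sym G y x) e

  adjacent⇒distinct : ∀ {x y} → adj G x y ≡ true → x ≢ y
  adjacent⇒distinct {x} xy refl = contradiction (trans (≡-sym xy) (irrefl G x)) λ ()

  clique-trans : ∀ {c} → UnionOfCliques G c → ∀ {x y z} →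
                 col G x ≡ c → col G y ≡ c → col G z ≡ c →
                 adj G x y ≡ true → adj G y z ≡ true → x ≢ z → adj G x z ≡ true
  clique-trans (_ , cliques) cx cy cz xy yz x≢z =
    proj₂ (cliques _ _ cx cz x≢z)
      (trans (proj₁ (cliques _ _ cx cy (adjacent⇒distinct xy)) xy)
             (proj₁ (cliques _ _ cy cz (adjacent⇒distinct yz)) yz))

  embedding-injective : ∀ {n} {H : FGraph n} (f : Fin n → ℕ) → TwinFree H →
                        (∀ i → col G (f i) ≡ FGraph.col H i) →
                        (∀ i j → adj G (f i) (f j) ≡ FGraph.adj H i j) →
                        Injective _≡_ _≡_ f
  embedding-injective f twinFree f-col f-adj {i} {j} fi≡fj =
    twinFree i j (trans (≡-sym (f-col i)) (trans (cong (col G) fi≡fj) (f-col j)))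
      λ k → trans (≡-sym (f-adj i k)) (trans (cong (λ v → adj G v (f k)) fi≡fj) (f-adj j k))

  adj-diag : ∀ {n} (H : FGraph n) x i → adj G x x ≡ FGraph.adj H i i
  adj-diag H x i = trans (irrefl G x) (≡-sym (FGraph.irrefl H i))

  adj-mirror : ∀ {n} (H : FGraph n) {x y i j} →
               adj G x y ≡ FGraph.adj H i j → adj G y x ≡ FGraph.adj H j i
  adj-mirror H {i = i} {j} e = trans (adj-flip e) (FGraph.sym H i j)

  realized : ∀ {n} (H : FGraph n) → TwinFree H → (f : Fin n → ℕ) →
             (∀ i → col G (f i) ≡ FGraph.col H i) →
             (∀ i j → adj G (f i) (f j) ≡ FGraph.adj H i j) → Realized G H
  realized H twinFree f f-col f-adj =
    f , embedding-injective {H = H} f twinFree f-col f-adj , f-col , f-adj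

  realized₂ : (H : FGraph 2) → TwinFree H → (a b : ℕ) →
              col G a ≡ FGraph.col H 0F → col G b ≡ FGraph.col H 1F →
              adj G a b ≡ FGraph.adj H 0F 1F → Realized G H
  realized₂ H twinFree a b ca cb ab = realized H twinFree (a ∷ b ∷ []) cols adjs
    where
    cols : ∀ i → col G ((a ∷ b ∷ []) i) ≡ FGraph.col H i
    cols 0F = ca
    cols 1F = cb
    adjs : ∀ i j → adj G ((a ∷ b ∷ []) i) ((a ∷ b ∷ []) j) ≡ FGraph.adj H i j
    adjs 0F 0F = adj-diag H a 0F
    adjs 0F 1F = ab
    adjs 1F 0F = adj-mirror H ab
    adjs 1F 1F = adj-diag H b 1F

  realized₃ : (H : FGraph 3) → TwinFree H → (a b c : ℕ) →
              col G a ≡ FGraph.col H 0F → col G b ≡ FGraph.col H 1F → col G c ≡ FGraph.col H 2F →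
              adj G a b ≡ FGraph.adj H 0F 1F → adj G a c ≡ FGraph.adj H 0F 2F →
              adj G b c ≡ FGraph.adj H 1F 2F → Realized G H
  realized₃ H twinFree a b c ca cb cc ab ac bc = realized H twinFree (a ∷ b ∷ c ∷ []) cols adjs
    where
    cols : ∀ i → col G ((a ∷ b ∷ c ∷ []) i) ≡ FGraph.col H i
    cols 0F = ca
    cols 1F = cb
    cols 2F = cc
    adjs : ∀ i j → adj G ((a ∷ b ∷ c ∷ []) i) ((a ∷ b ∷ c ∷ []) j) ≡ FGraph.adj H i j
    adjs 0F 0F = adj-diag H a 0F
    adjs 0F 1F = ab
    adjs 0F 2F = ac
    adjs 1F 0F = adj-mirror H ab
    adjs 1F 1F = adj-diag H b 1F
    adjs 1F 2F = bc
    adjs 2F 0F = adj-mirror H ac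
    adjs 2F 1F = adj-mirror H bc
    adjs 2F 2F = adj-diag H c 2F

  realized₄ : (H : FGraph 4) → TwinFree H → (a b c d : ℕ) →
              col G a ≡ FGraph.col H 0F → col G b ≡ FGraph.col H 1F →
              col G c ≡ FGraph.col H 2F → col G d ≡ FGraph.col H 3F →
              adj G a b ≡ FGraph.adj H 0F 1F → adj G a c ≡ FGraph.adj H 0F 2F →
              adj G a d ≡ FGraph.adj H 0F 3F → adj G b c ≡ FGraph.adj H 1F 2F →
              adj G b d ≡ FGraph.adj H 1F 3F → adj G c d ≡ FGraph.adj H 2F 3F → Realized G H
  realized₄ H twinFree a b c d ca cb cc cd ab ac ad bc bd cd′ =
    realized H twinFree (a ∷ b ∷ c ∷ d ∷ []) cols adjs
    where
    cols : ∀ i → col G ((a ∷ b ∷ c ∷ d ∷ []) i) ≡ FGraph.col H i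
    cols 0F = ca
    cols 1F = cb
    cols 2F = cc
    cols 3F = cd
    adjs : ∀ i j → adj G ((a ∷ b ∷ c ∷ d ∷ []) i) ((a ∷ b ∷ c ∷ d ∷ []) j) ≡ FGraph.adj H i j
    adjs 0F 0F = adj-diag H a 0F
    adjs 0F 1F = ab
    adjs 0F 2F = ac
    adjs 0F 3F = ad
    adjs 1F 0F = adj-mirror H ab
    adjs 1F 1F = adj-diag H b 1F
    adjs 1F 2F = bc
    adjs 1F 3F = bd
    adjs 2F 0F = adj-mirror H ac
    adjs 2F 1F = adj-mirror H bc
    adjs 2F 2F = adj-diag H c 2F
    adjs 2F 3F = cd′
    adjs 3F 0F = adj-mirror H ad
    adjs 3F 1F = adj-mirror H bd
    adjs 3F 2F = adj-mirror H cd′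
    adjs 3F 3F = adj-diag H d 3F

  realized-reindex : ∀ {k m n} {H : FGraph n} {h : Fin k → Fin n} → Realized G (restrict H h) →
                     (g : Fin m → Fin n) → Injective _≡_ _≡_ g →
                     (p : Fin m → Fin k) → (∀ i → h (p i) ≡ g i) → Realized G (restrict H g)
  realized-reindex {H = H} {h} (f , f-inj , f-col , f-adj) g g-inj p hp≡g =
    f ∘ p ,
    (λ e → g-inj (trans (≡-sym (hp≡g _)) (trans (cong h (f-inj e)) (hp≡g _)))) ,
    (λ i → trans (f-col (p i)) (cong (FGraph.col H) (hp≡g i))) ,
    λ i j → trans (f-adj (p i) (p j)) (cong₂ (FGraph.adj H) (hp≡g i) (hp≡g j))

  minOmitted-by-deletions : ∀ {n} {H : FGraph (suc n)} → Omitted G H →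
                            (∀ k → Realized G (H ∖ k)) → MinOmitted G H
  minOmitted-by-deletions {H = H} omitted deletions = omitted , λ m m<n g g-inj →
    let k , g≢k = missed-value m<n g in
    realized-reindex {H = H} {punchIn k} (deletions k) g g-inj
      (λ i → punchOut (g≢k i ∘ ≡-sym)) (λ i → punchIn-punchOut _)

  deletions-realized : ∀ {n} {H : FGraph (suc n)} → MinOmitted G H → ∀ k → Realized G (H ∖ k)
  deletions-realized (_ , proper) k = proper _ (n<1+n _) (punchIn k) (punchIn-injective k _ _)

  module _ (uh : Ultrahomogeneous G) where

    extend : ∀ {n} {H : FGraph n} (e e′ : Realized G H) (x : ℕ) →
             Σ ℕ λ y → col G y ≡ col G x × (∀ i → adj G (proj₁ e′ i) y ≡ adj G (proj₁ e i) x)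
    extend (f , f-inj , f-col , f-adj) (g , g-inj , g-col , g-adj) x
      with uh _ f g f-inj g-inj (λ i → trans (f-col i) (≡-sym (g-col i)))
                                (λ i j → trans (f-adj i j) (≡-sym (g-adj i j)))
    ... | σ , (σ-col , σ-adj) , σf≡g =
      Inverse.to σ x , σ-col x ,
      λ i → trans (cong (λ v → adj G v (Inverse.to σ x)) (≡-sym (σf≡g i))) (σ-adj (f i) x)

    common-neighbour-transfer :
      ∀ {x y z x′ y′} → col G x ≡ red → col G y ≡ blue →
      adj G x y ≡ true → adj G x z ≡ true → adj G y z ≡ true →
      col G x′ ≡ red → col G y′ ≡ blue → adj G x′ y′ ≡ true →
      Σ ℕ λ z′ → col G z′ ≡ col G z × adj G x′ z′ ≡ true × adj G y′ z′ ≡ true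
    common-neighbour-transfer {x} {y} {z} {x′} {y′} cx cy xy xz yz cx′ cy′ x′y′
      with extend {H = red-blue-edge}
             (realized₂ red-blue-edge red-blue-edge-twinFree x y cx cy xy)
             (realized₂ red-blue-edge red-blue-edge-twinFree x′ y′ cx′ cy′ x′y′) z
    ... | z′ , cz′ , adjs = z′ , cz′ , trans (adjs 0F) xz , trans (adjs 1F) yz

module _ (G : CGraph) where

  Dtilde∖r₁-realized : Realized G (D ∖ 0F) → Realized G (Dtilde ∖ 0F)
  Dtilde∖r₁-realized (g , _ , g-col , g-adj) =
    realized₃ G (Dtilde ∖ 0F) (Dtilde-deletion-twinFree 0F) (g 0F) (g 2F) (g 1F)
      (g-col 0F) (g-col 2F) (g-col 1F) (g-adj 0F 2F) (g-adj 0F 1F) (g-adj 2F 1F)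

  Dtilde∖b₁-realized : Realized G (D ∖ 2F) → Realized G (Dtilde ∖ 2F)
  Dtilde∖b₁-realized (g , _ , g-col , g-adj) =
    realized₃ G (Dtilde ∖ 2F) (Dtilde-deletion-twinFree 2F) (g 1F) (g 0F) (g 2F)
      (g-col 1F) (g-col 0F) (g-col 2F) (g-adj 1F 0F) (g-adj 1F 2F) (g-adj 0F 2F)

  module _ (uh : Ultrahomogeneous G) where

    red-apex : Realized G (D ∖ 3F) → ∀ {x y} → col G x ≡ red → col G y ≡ blue → adj G x y ≡ true →
               Σ ℕ λ s → col G s ≡ red × adj G x s ≡ true × adj G y s ≡ true
    red-apex (t , _ , t-col , t-adj) cx cy xy =
      let s , cs , xs , ys = common-neighbour-transfer G uh (t-col 0F) (t-col 2F) (t-adj 0F 2F)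
                               (t-adj 0F 1F) (t-adj 2F 1F) cx cy xy
      in s , trans cs (t-col 1F) , xs , ys

    blue-apex : Realized G (D ∖ 1F) → ∀ {x y} → col G x ≡ red → col G y ≡ blue → adj G x y ≡ true →
                Σ ℕ λ s → col G s ≡ blue × adj G x s ≡ true × adj G y s ≡ true
    blue-apex (t , _ , t-col , t-adj) cx cy xy =
      let s , cs , xs , ys = common-neighbour-transfer G uh (t-col 0F) (t-col 1F) (t-adj 0F 1F)
                               (t-adj 0F 2F) (t-adj 1F 2F) cx cy xy
      in s , trans cs (t-col 2F) , xs , ys

    module _ (D-omitted : Omitted G D) where

      Dtilde∖b₂-realized : Realized G (D ∖ 3F) → Realized G (D ∖ 0F) → Realized G (Dtilde ∖ 3F)
      Dtilde∖b₂-realized triangle (g , _ , g-col , g-adj) =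
        let s , cs , r₂s , b₁s = red-apex triangle (g-col 0F) (g-col 1F) (g-adj 0F 1F)
        in from-apex cs r₂s b₁s (adj G s (g 2F)) refl
        where
        from-apex : ∀ {s} → col G s ≡ red → adj G (g 0F) s ≡ true → adj G (g 1F) s ≡ true →
                    ∀ b → adj G s (g 2F) ≡ b → Realized G (Dtilde ∖ 3F)
        from-apex {s} cs r₂s b₁s true sb₂ = contradiction
          (realized₄ G D D-twinFree s (g 0F) (g 1F) (g 2F) cs (g-col 0F) (g-col 1F) (g-col 2F)
             (adj-flip G r₂s) (adj-flip G b₁s) sb₂ (g-adj 0F 1F) (g-adj 0F 2F) (g-adj 1F 2F))
          D-omitted
        from-apex {s} cs r₂s _ false sb₂ =
          realized₃ G (Dtilde ∖ 3F) (Dtilde-deletion-twinFree 3F) (g 0F) s (g 2F)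
            (g-col 0F) cs (g-col 2F) r₂s (g-adj 0F 2F) sb₂

      Dtilde∖r₂-realized : Realized G (D ∖ 1F) → Realized G (D ∖ 2F) → Realized G (Dtilde ∖ 1F)
      Dtilde∖r₂-realized triangle (g , _ , g-col , g-adj) =
        let s , cs , r₁s , b₂s = blue-apex triangle (g-col 0F) (g-col 2F) (g-adj 0F 2F)
        in from-apex cs r₁s b₂s (adj G (g 1F) s) refl
        where
        from-apex : ∀ {s} → col G s ≡ blue → adj G (g 0F) s ≡ true → adj G (g 2F) s ≡ true →
                    ∀ b → adj G (g 1F) s ≡ b → Realized G (Dtilde ∖ 1F)
        from-apex {s} cs r₁s b₂s true r₂s = contradiction
          (realized₄ G D D-twinFree (g 0F) (g 1F) s (g 2F) (g-col 0F) (g-col 1F) cs (g-col 2F)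
             (g-adj 0F 1F) r₁s (g-adj 0F 2F) r₂s (g-adj 1F 2F) (adj-flip G b₂s))
          D-omitted
        from-apex {s} cs _ b₂s false r₂s =
          realized₃ G (Dtilde ∖ 1F) (Dtilde-deletion-twinFree 1F) (g 1F) (g 2F) s
            (g-col 1F) (g-col 2F) cs (g-adj 1F 2F) r₂s b₂s

      Dtilde-omitted : UnionOfCliques G blue → Realized G (D ∖ 3F) → Omitted G Dtilde
      Dtilde-omitted blue-cliques triangle (h , _ , h-col , h-adj) =
        let s , cs , r₂s , b₂s = red-apex triangle (h-col 1F) (h-col 3F) (h-adj 1F 3F)
        in from-apex cs r₂s b₂s (adj G s (h 2F)) refl
        where
        from-blue-neighbour : ∀ {z} → col G z ≡ blue → adj G (h 1F) z ≡ true →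
                              adj G (h 0F) z ≡ true → adj G (h 2F) z ≡ true → ⊥
        from-blue-neighbour {z} cz r₂z r₁z b₁z = D-omitted
          (realized₄ G D D-twinFree (h 1F) (h 0F) z (h 3F) (h-col 1F) (h-col 0F) cz (h-col 3F)
             (h-adj 1F 0F) r₂z (h-adj 1F 3F) r₁z (h-adj 0F 3F) (adj-flip G b₂z))
          where
          b₂≢z : h 3F ≢ z
          b₂≢z b₂≡z =
            contradiction (trans (≡-sym (trans (cong (adj G (h 0F)) b₂≡z) r₁z)) (h-adj 0F 3F)) λ ()
          b₂z : adj G (h 3F) z ≡ true
          b₂z = clique-trans G blue-cliques (h-col 3F) (h-col 2F) cz (h-adj 3F 2F) b₁z b₂≢z

        from-apex : ∀ {s} → col G s ≡ red → adj G (h 1F) s ≡ true → adj G (h 3F) s ≡ true →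
                    ∀ b → adj G s (h 2F) ≡ b → ⊥
        from-apex {s} cs r₂s b₂s true sb₁ = D-omitted
          (realized₄ G D D-twinFree s (h 1F) (h 3F) (h 2F) cs (h-col 1F) (h-col 3F) (h-col 2F)
             (adj-flip G r₂s) (adj-flip G b₂s) sb₁ (h-adj 1F 3F) (h-adj 1F 2F) (h-adj 3F 2F))
        from-apex {s} cs r₂s b₂s false sb₁ =
          let z , cz , adjs = extend G uh {H = Dtilde ∖ 3F}
                (realized₃ G (Dtilde ∖ 3F) (Dtilde-deletion-twinFree 3F) (h 1F) s (h 2F)
                   (h-col 1F) cs (h-col 2F) r₂s (h-adj 1F 2F) sb₁)
                (realized₃ G (Dtilde ∖ 3F) (Dtilde-deletion-twinFree 3F) (h 1F) (h 0F) (h 2F)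
                   (h-col 1F) (h-col 0F) (h-col 2F) (h-adj 1F 0F) (h-adj 1F 2F) (h-adj 0F 2F))
                (h 3F)
          in from-blue-neighbour (trans cz (h-col 3F)) (trans (adjs 0F) (h-adj 1F 3F))
               (trans (adjs 1F) (adj-flip G b₂s)) (trans (adjs 2F) (h-adj 2F 3F))

lemma5p5 : (G : CGraph) → CUH G → Basic G → Omitted G D →
           Σ Color (λ c → NotIndependent G c) →
           MinOmitted G D → MinOmitted G Dtilde
lemma5p5 G (uh , _ , blue-cliques) _ D-omitted _ D-minOmitted =
  minOmitted-by-deletions G {H = Dtilde} (Dtilde-omitted G uh D-omitted blue-cliques (D∖ 3F)) Dtilde∖
  where
  D∖ : ∀ k → Realized G (D ∖ k)
  D∖ = deletions-realized G {H = D} D-minOmitted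

  Dtilde∖ : ∀ k → Realized G (Dtilde ∖ k)
  Dtilde∖ 0F = Dtilde∖r₁-realized G (D∖ 0F)
  Dtilde∖ 1F = Dtilde∖r₂-realized G uh D-omitted (D∖ 1F) (D∖ 2F)
  Dtilde∖ 2F = Dtilde∖b₁-realized G (D∖ 2F)
  Dtilde∖ 3F = Dtilde∖b₂-realized G uh D-omitted (D∖ 3F) (D∖ 0F)
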